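{- For every integer $i\ge 7$, \[ F_{i-3}=Q_i\,\Delta\bigl(1-(i\bmod 2)\bigr)\qquad\text{and}\qquad F_{i-5}F_{i-4}=Q_i\,\Delta(i\bmod 2). \]
   Context: Fibonacci words: $F_1=\texttt{b}$, $F_2=\texttt{a}$, $F_i=F_{i-1}F_{i-2}$ for $i\ge 3$. For $i\ge 7$, $Q_i:=F_{i-5}F_{i-6}\cdots F_3F_2$ (concatenation of the $i-6$ Fibonacci words $F_{i-5},\dots,F_2$ in decreasing index order; e.g. $Q_7=F_2$). For $j\in\{0,1\}$, $\Delta(0)=\texttt{ba}$ and $\Delta(1)=\texttt{ab}$. -}

module Defs where

open import Data.Nat using (ℕ; zero; suc; _∸_)
open import Data.List using (List; []; _∷_; _++_)

data Letter : Set where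
  a b : Letter

Word : Set
Word = List Letter

-- Fibonacci words: F 1 = b, F 2 = a, F i = F (i-1) F (i-2) for i ≥ 3.
-- (F 0 is an unused dummy value.)
F : ℕ → Word
F zero = []
F (suc zero) = b ∷ []
F (suc (suc zero)) = a ∷ []
F (suc (suc (suc n))) = F (suc (suc n)) ++ F (suc n)

-- Qaux k = F (k+2) F (k+1) ... F 2  (k+1 factors, decreasing index)
Qaux : ℕ → Word
Qaux zero = F 2
Qaux (suc k) = F (suc k + 2) ++ Qaux k
  where open import Data.Nat using (_+_)

-- Q i = F (i-5) F (i-6) ... F 2, meaningful for i ≥ 7
Q : ℕ → Word
Q i = Qaux (i ∸ 7)

Δ : ℕ → Word
Δ zero = b ∷ a ∷ []
Δ (suc _) = a ∷ b ∷ []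

{-# OPTIONS --safe #-}
-- Write k = i − 7, so Q i = Qaux k = F (k+2) ⋯ F 2.  Both identities hold for k = 0,
-- and since Qaux (k+1) = F (k+3) Qaux k, unfolding F (k+5) = F (k+3) F (k+2) F (k+3)
-- and F (k+3) F (k+4) = F (k+3) F (k+3) F (k+2) turns the identities for k into those
-- for k + 1 with the two suffixes exchanged; the parity of i records which is which.
module Submission where

open import Defs
open import Data.Nat using (ℕ; zero; suc; _≤_; _∸_; _%_; _+_)
open import Data.Nat.Properties using (+-comm; m≤n⇒∃[o]m+o≡n)
open import Data.List using (_++_)
open import Data.List.Properties using (++-assoc)
open import Data.Product using (_×_; _,_)
open import Relation.Binary.PropositionalEquality
  using (_≡_; refl; sym; trans; cong; module ≡-Reasoning)

[1+n]%2≡1∸n%2 : ∀ n → suc n % 2 ≡ 1 ∸ n % 2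
[1+n]%2≡1∸n%2 zero          = refl
[1+n]%2≡1∸n%2 (suc zero)    = refl
[1+n]%2≡1∸n%2 (suc (suc n)) = [1+n]%2≡1∸n%2 n

1∸[1+n]%2≡n%2 : ∀ n → 1 ∸ suc n % 2 ≡ n % 2
1∸[1+n]%2≡n%2 zero          = refl
1∸[1+n]%2≡n%2 (suc zero)    = refl
1∸[1+n]%2≡n%2 (suc (suc n)) = 1∸[1+n]%2≡n%2 n

Qaux-suc : ∀ k → Qaux (suc k) ≡ F (3 + k) ++ Qaux k
Qaux-suc k = cong (λ n → F n ++ Qaux k) (+-comm (suc k) 2)

prepend-F : ∀ k {w u} → w ≡ Qaux k ++ u → F (3 + k) ++ w ≡ Qaux (suc k) ++ u
prepend-F k {w} {u} w≡Qu = begin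
  F (3 + k) ++ w               ≡⟨ cong (F (3 + k) ++_) w≡Qu ⟩
  F (3 + k) ++ (Qaux k ++ u)   ≡⟨ ++-assoc (F (3 + k)) (Qaux k) u ⟨
  (F (3 + k) ++ Qaux k) ++ u   ≡⟨ cong (_++ u) (Qaux-suc k) ⟨
  Qaux (suc k) ++ u            ∎
  where open ≡-Reasoning

suffix-swap : ∀ k {u v} →
  F (4 + k) ≡ Qaux k ++ u → F (2 + k) ++ F (3 + k) ≡ Qaux k ++ v →
  F (5 + k) ≡ Qaux (suc k) ++ v × F (3 + k) ++ F (4 + k) ≡ Qaux (suc k) ++ u
suffix-swap k F₄≡Qu F₂F₃≡Qv =
    trans (++-assoc (F (3 + k)) (F (2 + k)) (F (3 + k))) (prepend-F k F₂F₃≡Qv)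
  , prepend-F k F₄≡Qu

Qaux-suffixes : ∀ k →
  F (4 + k) ≡ Qaux k ++ Δ (1 ∸ (7 + k) % 2) × F (2 + k) ++ F (3 + k) ≡ Qaux k ++ Δ ((7 + k) % 2)
Qaux-suffixes zero    = refl , refl
Qaux-suffixes (suc k) =
  let F₄≡Qu , F₂F₃≡Qv = Qaux-suffixes k
      F₅≡Qv , F₃F₄≡Qu = suffix-swap k F₄≡Qu F₂F₃≡Qv
  in trans F₅≡Qv (cong (λ j → Qaux (suc k) ++ Δ j) (sym (1∸[1+n]%2≡n%2 (7 + k))))
   , trans F₃F₄≡Qu (cong (λ j → Qaux (suc k) ++ Δ j) (sym ([1+n]%2≡1∸n%2 (7 + k))))

lemma10 : (i : ℕ) → 7 ≤ i →
    (F (i ∸ 3) ≡ Q i ++ Δ (1 ∸ (i % 2)))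
      × (F (i ∸ 5) ++ F (i ∸ 4) ≡ Q i ++ Δ (i % 2))
lemma10 i 7≤i with k , refl ← m≤n⇒∃[o]m+o≡n 7≤i = Qaux-suffixes k
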